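{- Let $n$ be a positive integer and $t$ an integer with $0\leq t\leq n$. Then for each integer $i$ with $0\le i\le \lfloor (n-1)/2\rfloor$, \[ \sum_{j=1}^{n}\sum_{r=i}^{\lfloor (j-1)/2\rfloor}\sum_{k=0}^{j-1-2r}\binom{n}{j}\binom{j-1-r}{r}\binom{j-1-2r}{k}\binom{r}{i}\binom{r-i}{j-k-r+i-n+t}(-1)^{r+t+j+n+i}2^{k} =\begin{cases}\binom{n-1-i}{i}, & t=0,\\ 0, & t\neq 0.\end{cases} \]
   Context: Binomial coefficients $\binom{a}{b}$ with $a\ge 0$ an integer are $0$ when $b<0$ or $b>a$. Empty sums are $0$. -}

module Defs where

open import Data.Nat using (ℕ; zero; suc; _≤ᵇ_)
open import Data.Nat.Combinatorics using (_C_)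
open import Data.Integer using (ℤ; +_; -[1+_]; _+_)
open import Data.Bool using (if_then_else_)

binomℤ : ℕ → ℤ → ℤ
binomℤ a (+ b)      = + (a C b)
binomℤ a -[1+ b ]   = + 0

sumFrom : ℕ → ℕ → (ℕ → ℤ) → ℤ
sumFrom lo zero      f = + 0
sumFrom lo (suc len) f = f lo + sumFrom (suc lo) len f

sumRange : ℕ → ℕ → (ℕ → ℤ) → ℤ
sumRange lo hi f = if lo ≤ᵇ hi then sumFrom lo (suc hi Data.Nat.∸ lo) f else + 0

module Submission where

-- Put r = i + ρ and j = 1 + m + 2ρ + 2i.  Then j - 1 - 2r = m, j - 1 - r = m + ρ + i, and
-- the bottom index of the last binomial is m + ρ - q - k with q = (n - t) - (2i + 1).  So
--   * the k-sum is (up to sign and C(n,j)) the kernel  K m ρ q = Σ_k C(m,k) 2^k C(ρ, m+ρ-q-k),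
--     the coefficient of x^q in (x+2)^m (x+1)^ρ;
--   * for fixed j the r-sum is the anti-diagonal sum
--       F i N q = Σ_{m+2ρ=N} C(m+ρ+i, ρ+i) C(ρ+i, i) (-1)^ρ K m ρ q     (N = j - 1 - 2i).
-- The two Pascal-type recurrences of K give a linear recurrence for F in N, with a forcing
-- term coming from the index i - 1; the closed form C(q+i, i) C(N+2i+1, q+2i+1) (zero for
-- q < 0) satisfies the same recurrence and initial values, so it equals F (induction on i, N).
-- Finally the j-sum is an alternating binomial sum  Σ_j C(n,j) C(j,s) (-1)^(j+n) = [n = s]
-- with s = q + 2i + 1 = n - t, which is nonzero exactly when t = 0.

open import Defs
open import Data.Nat using (ℕ; _≤_; _∸_; _/_; _≡ᵇ_)
open import Data.Nat.Combinatorics using (_C_)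
open import Data.Integer using (ℤ; +_; -_; _+_; _-_; _*_; _^_)
open import Data.Bool using (if_then_else_)
open import Relation.Binary.PropositionalEquality using (_≡_)

open import Data.Nat using (zero; suc; _<_; z≤n; s≤s)
import Data.Nat as N
import Data.Nat.Properties as NP
import Data.Nat.DivMod as DM
open import Data.Nat.Combinatorics using (nCk+nC[k+1]≡[n+1]C[k+1]; k>n⇒nCk≡0; nCn≡1)
open import Data.Integer using (-[1+_])
import Data.Integer.Properties as ZP
open import Data.Bool using (true; false; T)
open import Relation.Nullary using (¬_; yes; no)
open import Relation.Nullary.Negation using (contradiction)
open import Relation.Binary.PropositionalEquality
  using (_≢_; refl; sym; trans; cong; cong₂; subst; module ≡-Reasoning)
open import Data.Integer.Tactic.RingSolver using (solve-∀)
import Data.Nat.Tactic.RingSolver as NS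

-- Binomial coefficients by Pascal's rule.  Unlike _C_ they reduce on successor
-- arguments, which keeps the recurrences below definitional.
binom : ℕ → ℕ → ℕ
binom _       zero    = 1
binom zero    (suc k) = 0
binom (suc n) (suc k) = binom n k N.+ binom n (suc k)

binom≡C : ∀ n k → n C k ≡ binom n k
binom≡C n       zero    = refl
binom≡C zero    (suc k) = refl
binom≡C (suc n) (suc k) =
  trans (sym (nCk+nC[k+1]≡[n+1]C[k+1] n k)) (cong₂ N._+_ (binom≡C n k) (binom≡C n (suc k)))

binom-above : ∀ n k → n < k → binom n k ≡ 0
binom-above n k n<k = trans (sym (binom≡C n k)) (k>n⇒nCk≡0 n<k)

binom-diag : ∀ n → binom n n ≡ 1
binom-diag n = trans (sym (binom≡C n n)) (nCn≡1 n)

binom-subdiag : ∀ n → binom (suc n) n ≡ suc n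
binom-subdiag zero    = refl
binom-subdiag (suc n) = trans (cong₂ N._+_ (binom-subdiag n) (binom-diag (suc n))) (NP.+-comm (suc n) 1)

binomZ : ℕ → ℤ → ℤ
binomZ a (+ b)    = + binom a b
binomZ a -[1+ b ] = + 0

binomℤ≡binomZ : ∀ a b → binomℤ a b ≡ binomZ a b
binomℤ≡binomZ a (+ b)    = cong +_ (binom≡C a b)
binomℤ≡binomZ a -[1+ b ] = refl

binomZ-pascal : ∀ ρ x → binomZ (suc ρ) x ≡ binomZ ρ x + binomZ ρ (x - + 1)
binomZ-pascal ρ (+ zero)  = refl
binomZ-pascal ρ (+ suc x) = ZP.+-comm (+ binom ρ x) (+ binom ρ (suc x))
binomZ-pascal ρ -[1+ x ]  = refl

sign : ℕ → ℤ
sign k = (- (+ 1)) ^ k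

sign-+ : ∀ a b → sign (a N.+ b) ≡ sign a * sign b
sign-+ a b = ZP.^-distribˡ-+-* (- (+ 1)) a b

sign-square : ∀ i → sign i * sign i ≡ + 1
sign-square zero    = refl
sign-square (suc i) = trans (negate-twice (sign i)) (sign-square i)
  where
  negate-twice : ∀ (s : ℤ) → (- (+ 1) * s) * (- (+ 1) * s) ≡ s * s
  negate-twice = solve-∀

double : ℕ → ℕ
double i = i N.+ i

half-bound : ∀ N ρ → ρ ≤ N / 2 → 2 N.* ρ ≤ N
half-bound N ρ ρ≤N/2 =
  NP.≤-trans (NP.*-monoʳ-≤ 2 ρ≤N/2) (NP.≤-trans (NP.≤-reflexive (NP.*-comm 2 (N / 2))) (DM.m/n*n≤m N 2))

double-bound : ∀ N i → i ≤ N / 2 → double i ≤ N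
double-bound N i i≤N/2 = subst (N._≤ N) (cong (i N.+_) (NP.+-identityʳ i)) (half-bound N i i≤N/2)

sumFrom-cong : ∀ a L {f g : ℕ → ℤ} → (∀ x → f x ≡ g x) → sumFrom a L f ≡ sumFrom a L g
sumFrom-cong a zero    eq = refl
sumFrom-cong a (suc L) eq = cong₂ _+_ (eq a) (sumFrom-cong (suc a) L eq)

sumFrom-shift : ∀ a L (f : ℕ → ℤ) → sumFrom (suc a) L f ≡ sumFrom a L (λ x → f (suc x))
sumFrom-shift a zero    f = refl
sumFrom-shift a (suc L) f = cong (_+_ (f (suc a))) (sumFrom-shift (suc a) L f)

sumFrom-offset : ∀ a L (f : ℕ → ℤ) → sumFrom a L f ≡ sumFrom 0 L (λ x → f (a N.+ x))
sumFrom-offset zero    L f = refl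
sumFrom-offset (suc a) L f = trans (sumFrom-shift a L f) (sumFrom-offset a L (λ x → f (suc x)))

sumFrom-+ : ∀ a L (f g : ℕ → ℤ) → sumFrom a L (λ x → f x + g x) ≡ sumFrom a L f + sumFrom a L g
sumFrom-+ a zero    f g = refl
sumFrom-+ a (suc L) f g =
  trans (cong (_+_ (f a + g a)) (sumFrom-+ (suc a) L f g)) (interchange (f a) (g a) _ _)
  where
  interchange : ∀ (a b c d : ℤ) → (a + b) + (c + d) ≡ (a + c) + (b + d)
  interchange = solve-∀

sumFrom-* : ∀ a L (c : ℤ) (f : ℕ → ℤ) → sumFrom a L (λ x → c * f x) ≡ c * sumFrom a L f
sumFrom-* a zero    c f = sym (ZP.*-zeroʳ c)
sumFrom-* a (suc L) c f =
  trans (cong (_+_ (c * f a)) (sumFrom-* (suc a) L c f)) (sym (ZP.*-distribˡ-+ c (f a) _))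

sumFrom-zero : ∀ a L (f : ℕ → ℤ) → (∀ x → f x ≡ + 0) → sumFrom a L f ≡ + 0
sumFrom-zero a zero    f eq = refl
sumFrom-zero a (suc L) f eq = cong₂ _+_ (eq a) (sumFrom-zero (suc a) L f eq)

sumFrom-snoc : ∀ a L (f : ℕ → ℤ) → sumFrom a (suc L) f ≡ sumFrom a L f + f (a N.+ L)
sumFrom-snoc a zero    f =
  trans (ZP.+-identityʳ (f a)) (trans (cong f (sym (NP.+-identityʳ a))) (sym (ZP.+-identityˡ _)))
sumFrom-snoc a (suc L) f =
  trans (cong (_+_ (f a)) (sumFrom-snoc (suc a) L f))
    (trans (sym (ZP.+-assoc (f a) _ _)) (cong (λ z → f a + sumFrom (suc a) L f + f z) (sym (NP.+-suc a L))))

sumFrom-cong< : ∀ L {f g : ℕ → ℤ} → (∀ x → x < L → f x ≡ g x) → sumFrom 0 L f ≡ sumFrom 0 L g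
sumFrom-cong< zero    eq = refl
sumFrom-cong< (suc L) {f} {g} eq = cong₂ _+_ (eq 0 (s≤s z≤n))
  (trans (sumFrom-shift 0 L f) (trans (sumFrom-cong< L (λ x x<L → eq (suc x) (s≤s x<L))) (sym (sumFrom-shift 0 L g))))

T⇒≡true : ∀ {b} → T b → b ≡ true
T⇒≡true {true} _ = refl

¬T⇒≡false : ∀ {b} → ¬ T b → b ≡ false
¬T⇒≡false {false} _   = refl
¬T⇒≡false {true}  ¬tt = contradiction _ ¬tt

sumRange-nonempty : ∀ lo h (f : ℕ → ℤ) → sumRange lo (lo N.+ h) f ≡ sumFrom 0 (suc h) (λ x → f (lo N.+ x))
sumRange-nonempty lo h f rewrite T⇒≡true (NP.≤⇒≤ᵇ (NP.m≤m+n lo h)) =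
  trans (cong (λ L → sumFrom lo L f) (trans (cong (N._∸ lo) (sym (NP.+-suc lo h))) (NP.m+n∸m≡n lo (suc h))))
    (sumFrom-offset lo (suc h) f)

sumRange-empty : ∀ lo hi (f : ℕ → ℤ) → hi < lo → sumRange lo hi f ≡ + 0
sumRange-empty lo hi f hi<lo rewrite ¬T⇒≡false (λ p → NP.<⇒≱ hi<lo (NP.≤ᵇ⇒≤ lo hi p)) = refl

transform : ℕ → (ℕ → ℤ) → ℤ
transform n f = sumFrom 0 (suc n) (λ j → + binom n j * f j)

transform-cong : ∀ n {f g : ℕ → ℤ} → (∀ j → f j ≡ g j) → transform n f ≡ transform n g
transform-cong n eq = sumFrom-cong 0 (suc n) (λ j → cong (+ binom n j *_) (eq j))

transform-+ : ∀ n (f g : ℕ → ℤ) → transform n (λ j → f j + g j) ≡ transform n f + transform n g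
transform-+ n f g =
  trans (sumFrom-cong 0 (suc n) (λ j → ZP.*-distribˡ-+ (+ binom n j) (f j) (g j)))
    (sumFrom-+ 0 (suc n) (λ j → + binom n j * f j) (λ j → + binom n j * g j))

transform-* : ∀ n (c : ℤ) (f : ℕ → ℤ) → transform n (λ j → c * f j) ≡ c * transform n f
transform-* n c f =
  trans (sumFrom-cong 0 (suc n) (λ j → swap (+ binom n j) c (f j)))
    (sumFrom-* 0 (suc n) c (λ j → + binom n j * f j))
  where
  swap : ∀ (b c x : ℤ) → b * (c * x) ≡ c * (b * x)
  swap = solve-∀

transform-zero : ∀ n → transform n (λ _ → + 0) ≡ + 0
transform-zero n = sumFrom-zero 0 (suc n) _ (λ j → ZP.*-zeroʳ (+ binom n j))

transform-pascal : ∀ n f → transform (suc n) f ≡ transform n (λ j → f j + f (suc j))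
transform-pascal n f =
  begin
    transform (suc n) f
  ≡⟨ cong (_+_ f₀) (sumFrom-shift 0 (suc n) (λ j → + binom (suc n) j * f j)) ⟩
    f₀ + sumFrom 0 (suc n) (λ j → + binom (suc n) (suc j) * f (suc j))
  ≡⟨ cong (_+_ f₀) (sumFrom-cong 0 (suc n) (λ j → ZP.*-distribʳ-+ (f (suc j)) (+ binom n j) (+ binom n (suc j)))) ⟩
    f₀ + sumFrom 0 (suc n) (λ j → + binom n j * f (suc j) + + binom n (suc j) * f (suc j))
  ≡⟨ cong (_+_ f₀) (sumFrom-+ 0 (suc n) (λ j → + binom n j * f (suc j)) (λ j → + binom n (suc j) * f (suc j))) ⟩
    f₀ + (X + Y)
  ≡⟨ rotate f₀ X Y ⟩
    (f₀ + Y) + X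
  ≡⟨ cong (_+ X) lower ⟩
    transform n f + X
  ≡⟨ sym (transform-+ n f (λ j → f (suc j))) ⟩
    transform n (λ j → f j + f (suc j))
  ∎
  where
  open ≡-Reasoning
  f₀ = + binom (suc n) 0 * f 0
  X = sumFrom 0 (suc n) (λ j → + binom n j * f (suc j))
  Y = sumFrom 0 (suc n) (λ j → + binom n (suc j) * f (suc j))
  rotate : ∀ (a x y : ℤ) → a + (x + y) ≡ (a + y) + x
  rotate = solve-∀
  -- the terms C(n, j) f j, reassembled; the extra last term C(n, n+1) f (n+1) vanishes
  lower : f₀ + Y ≡ transform n f
  lower = begin
      f₀ + Y
    ≡⟨ cong (_+_ f₀) (sym (sumFrom-shift 0 (suc n) (λ j → + binom n j * f j))) ⟩
      sumFrom 0 (suc (suc n)) (λ j → + binom n j * f j)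
    ≡⟨ sumFrom-snoc 0 (suc n) (λ j → + binom n j * f j) ⟩
      transform n f + + binom n (suc n) * f (suc n)
    ≡⟨ cong (λ z → transform n f + + z * f (suc n)) (binom-above n (suc n) NP.≤-refl) ⟩
      transform n f + + 0 * f (suc n)
    ≡⟨ ZP.+-identityʳ _ ⟩
      transform n f
    ∎

alternating : ℕ → ℕ → ℤ
alternating n s = transform n (λ j → + binom j s * sign (j N.+ n))

alternating-sum : ∀ n s → alternating n s ≡ (if n ≡ᵇ s then + 1 else + 0)
alternating-sum zero    zero    = refl
alternating-sum zero    (suc s) = refl
alternating-sum (suc n) zero    =
  trans (transform-pascal n (λ j → + binom j 0 * sign (j N.+ suc n)))
    (trans (transform-cong n (λ j → cancel (sign (j N.+ suc n)))) (transform-zero n))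
  where
  cancel : ∀ (x : ℤ) → + 1 * x + + 1 * (- (+ 1) * x) ≡ + 0
  cancel = solve-∀
alternating-sum (suc n) (suc s) =
  trans (transform-pascal n (λ j → + binom j (suc s) * sign (j N.+ suc n)))
    (trans (transform-cong n step) (alternating-sum n s))
  where
  pascal : ∀ (a b x : ℤ) → b * (- (+ 1) * x) + (a + b) * (- (+ 1) * (- (+ 1) * x)) ≡ a * x
  pascal = solve-∀
  step : ∀ j → + binom j (suc s) * sign (j N.+ suc n) + + binom (suc j) (suc s) * sign (suc j N.+ suc n)
             ≡ + binom j s * sign (j N.+ n)
  step j rewrite NP.+-suc j n = pascal (+ binom j s) (+ binom j (suc s)) (sign (j N.+ n))

-- Anti-diagonal sums  antidiag N g = Σ_{m + 2ρ = N} g m ρ.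
antidiag : ℕ → (ℕ → ℕ → ℤ) → ℤ
antidiag zero          g = g 0 0
antidiag (suc zero)    g = g 1 0
antidiag (suc (suc N)) g = g (suc (suc N)) 0 + antidiag N (λ m ρ → g m (suc ρ))

antidiag-cong : ∀ N {g h : ℕ → ℕ → ℤ} → (∀ m ρ → g m ρ ≡ h m ρ) → antidiag N g ≡ antidiag N h
antidiag-cong zero          eq = eq 0 0
antidiag-cong (suc zero)    eq = eq 1 0
antidiag-cong (suc (suc N)) eq = cong₂ _+_ (eq _ 0) (antidiag-cong N (λ m ρ → eq m (suc ρ)))

antidiag-+ : ∀ N (g h : ℕ → ℕ → ℤ) → antidiag N (λ m ρ → g m ρ + h m ρ) ≡ antidiag N g + antidiag N h
antidiag-+ zero          g h = refl
antidiag-+ (suc zero)    g h = refl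
antidiag-+ (suc (suc N)) g h =
  trans (cong (_+_ (g _ 0 + h _ 0)) (antidiag-+ N (λ m ρ → g m (suc ρ)) (λ m ρ → h m (suc ρ))))
    (interchange (g _ 0) (h _ 0) _ _)
  where
  interchange : ∀ (a b c d : ℤ) → (a + b) + (c + d) ≡ (a + c) + (b + d)
  interchange = solve-∀

antidiag-* : ∀ N (c : ℤ) (g : ℕ → ℕ → ℤ) → antidiag N (λ m ρ → c * g m ρ) ≡ c * antidiag N g
antidiag-* zero          c g = refl
antidiag-* (suc zero)    c g = refl
antidiag-* (suc (suc N)) c g =
  trans (cong (_+_ (c * g _ 0)) (antidiag-* N c (λ m ρ → g m (suc ρ)))) (sym (ZP.*-distribˡ-+ c _ _))

antidiag-neg : ∀ N (g : ℕ → ℕ → ℤ) → antidiag N (λ m ρ → - g m ρ) ≡ - antidiag N g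
antidiag-neg zero          g = refl
antidiag-neg (suc zero)    g = refl
antidiag-neg (suc (suc N)) g =
  trans (cong (_+_ (- g _ 0)) (antidiag-neg N (λ m ρ → g m (suc ρ)))) (sym (ZP.neg-distrib-+ (g _ 0) _))

antidiag-zero : ∀ N → antidiag N (λ _ _ → + 0) ≡ + 0
antidiag-zero zero          = refl
antidiag-zero (suc zero)    = refl
antidiag-zero (suc (suc N)) = trans (ZP.+-identityˡ _) (antidiag-zero N)

shiftM : (ℕ → ℕ → ℤ) → ℕ → ℕ → ℤ
shiftM g zero    ρ = + 0
shiftM g (suc m) ρ = g m ρ

antidiag-shiftM : ∀ N g → antidiag (suc N) (shiftM g) ≡ antidiag N g
antidiag-shiftM zero          g = refl
antidiag-shiftM (suc zero)    g = ZP.+-identityʳ _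
antidiag-shiftM (suc (suc N)) g = cong (_+_ (g (suc (suc N)) 0))
  (trans (antidiag-cong (suc N) (λ { zero ρ → refl ; (suc m) ρ → refl }))
    (antidiag-shiftM N (λ m ρ → g m (suc ρ))))

antidiag-as-sum : ∀ N (g : ℕ → ℕ → ℤ) → sumFrom 0 (suc (N / 2)) (λ ρ → g (N ∸ 2 N.* ρ) ρ) ≡ antidiag N g
antidiag-as-sum zero          g = ZP.+-identityʳ _
antidiag-as-sum (suc zero)    g = ZP.+-identityʳ _
antidiag-as-sum (suc (suc N)) g =
  trans (cong (λ h → sumFrom 0 (suc h) (λ ρ → g (suc (suc N) ∸ 2 N.* ρ) ρ))
               (DM.m/n≡1+[m∸n]/n {suc (suc N)} {2} (s≤s (s≤s z≤n))))
    (cong (_+_ (g (suc (suc N)) 0))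
      (trans (sumFrom-shift 0 (suc (N / 2)) (λ ρ → g (suc (suc N) ∸ 2 N.* ρ) ρ))
        (trans (sumFrom-cong 0 (suc (N / 2)) (λ ρ → cong (λ z → g (suc (suc N) ∸ z) (suc ρ)) (NP.*-suc 2 ρ)))
          (antidiag-as-sum N (λ m ρ → g m (suc ρ))))))

δ : ℤ → ℤ
δ (+ zero)  = + 1
δ (+ suc _) = + 0
δ -[1+ _ ]  = + 0

-- The kernel  K m ρ q = Σ_k C(m,k) 2^k C(ρ, m+ρ-q-k),  i.e. the coefficient of x^q in
-- (x+2)^m (x+1)^ρ.  It is kept opaque: everything the development needs about it is the
-- two recurrences, the initial value and (once) its defining formula.
opaque
  kernelTerm : ℕ → ℕ → ℤ → ℕ → ℤ
  kernelTerm m ρ q k = (+ 2) ^ k * binomZ ρ (+ m + + ρ - q - + k)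

  kernel : ℕ → ℕ → ℤ → ℤ
  kernel m ρ q = transform m (kernelTerm m ρ q)

  kernel-unfold : ∀ m ρ q → kernel m ρ q ≡ sumFrom 0 (suc m) (λ k → + binom m k * ((+ 2) ^ k * binomZ ρ (+ m + + ρ - q - + k)))
  kernel-unfold m ρ q = refl

  kernel-base : ∀ q → kernel 0 0 q ≡ δ q
  kernel-base (+ zero)  = refl
  kernel-base (+ suc q) = refl
  kernel-base -[1+ x ]  = refl

  -- multiplication by (x + 2)
  kernel-m-step : ∀ m ρ q → kernel (suc m) ρ q ≡ + 2 * kernel m ρ q + kernel m ρ (q - + 1)
  kernel-m-step m ρ q =
    begin
      kernel (suc m) ρ q
    ≡⟨ transform-pascal m (kernelTerm (suc m) ρ q) ⟩
      transform m (λ k → kernelTerm (suc m) ρ q k + kernelTerm (suc m) ρ q (suc k))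
    ≡⟨ transform-cong m step ⟩
      transform m (λ k → kernelTerm m ρ (q - + 1) k + + 2 * kernelTerm m ρ q k)
    ≡⟨ transform-+ m (kernelTerm m ρ (q - + 1)) (λ k → + 2 * kernelTerm m ρ q k) ⟩
      kernel m ρ (q - + 1) + transform m (λ k → + 2 * kernelTerm m ρ q k)
    ≡⟨ cong (_+_ (kernel m ρ (q - + 1))) (transform-* m (+ 2) (kernelTerm m ρ q)) ⟩
      kernel m ρ (q - + 1) + + 2 * kernel m ρ q
    ≡⟨ ZP.+-comm (kernel m ρ (q - + 1)) _ ⟩
      + 2 * kernel m ρ q + kernel m ρ (q - + 1)
    ∎
    where
    open ≡-Reasoning
    bottom₁ : ∀ (M R Q K : ℤ) → (+ 1 + M) + R - Q - K ≡ M + R - (Q - + 1) - K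
    bottom₁ = solve-∀
    bottom₂ : ∀ (M R Q K : ℤ) → (+ 1 + M) + R - Q - (+ 1 + K) ≡ M + R - Q - K
    bottom₂ = solve-∀
    step : ∀ k → kernelTerm (suc m) ρ q k + kernelTerm (suc m) ρ q (suc k)
               ≡ kernelTerm m ρ (q - + 1) k + + 2 * kernelTerm m ρ q k
    step k = cong₂ _+_ (cong (λ z → (+ 2) ^ k * binomZ ρ z) (bottom₁ (+ m) (+ ρ) q (+ k)))
      (trans (cong (λ z → + 2 * (+ 2) ^ k * binomZ ρ z) (bottom₂ (+ m) (+ ρ) q (+ k)))
        (ZP.*-assoc (+ 2) ((+ 2) ^ k) (binomZ ρ (+ m + + ρ - q - + k))))

  -- multiplication by (x + 1)
  kernel-ρ-step : ∀ m ρ q → kernel m (suc ρ) q ≡ kernel m ρ q + kernel m ρ (q - + 1)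
  kernel-ρ-step m ρ q =
    trans (transform-cong m step)
      (trans (transform-+ m (kernelTerm m ρ (q - + 1)) (kernelTerm m ρ q))
        (ZP.+-comm (kernel m ρ (q - + 1)) (kernel m ρ q)))
    where
    bottom₁ : ∀ (M R Q K : ℤ) → M + (+ 1 + R) - Q - K ≡ M + R - (Q - + 1) - K
    bottom₁ = solve-∀
    bottom₂ : ∀ (M R Q K : ℤ) → M + (+ 1 + R) - Q - K - + 1 ≡ M + R - Q - K
    bottom₂ = solve-∀
    step : ∀ k → kernelTerm m (suc ρ) q k ≡ kernelTerm m ρ (q - + 1) k + kernelTerm m ρ q k
    step k =
      trans (cong ((+ 2) ^ k *_) (binomZ-pascal ρ (+ m + + suc ρ - q - + k)))
        (trans (ZP.*-distribˡ-+ ((+ 2) ^ k) (binomZ ρ (+ m + + suc ρ - q - + k)) (binomZ ρ (+ m + + suc ρ - q - + k - + 1)))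
          (cong₂ (λ u v → (+ 2) ^ k * binomZ ρ u + (+ 2) ^ k * binomZ ρ v)
            (bottom₁ (+ m) (+ ρ) q (+ k)) (bottom₂ (+ m) (+ ρ) q (+ k))))

-- The summands of the r-sum after reindexing (r = i + ρ, m = j - 1 - 2r):
--   G i q m ρ = C(m+ρ+i, ρ+i) C(ρ+i, i) (-1)^ρ K m ρ q,
-- their anti-diagonal sums F i N q, and the same objects for the index i - 1
-- (zero when i = 0), which enter the recurrence for F as a forcing term.
G : ℕ → ℤ → ℕ → ℕ → ℤ
G i q m ρ = + binom (m N.+ (ρ N.+ i)) (ρ N.+ i) * + binom (ρ N.+ i) i * sign ρ * kernel m ρ q

F : ℕ → ℕ → ℤ → ℤ
F i N q = antidiag N (G i q)

Gprev : ℕ → ℤ → ℕ → ℕ → ℤ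
Gprev zero    q m ρ = + 0
Gprev (suc i) q m ρ = G i q m ρ

Fprev : ℕ → ℕ → ℤ → ℤ
Fprev i N q = antidiag N (Gprev i q)

-- The common shape of the recurrences satisfied by F and by its closed form:
--   X_{N+2}(q) = 2 X_{N+1}(q) + X_{N+1}(q-1) - X_N(q) - X_N(q-1) + (forcing term).
recurrence : ℤ → ℤ → ℤ → ℤ → ℤ → ℤ
recurrence a b c d e = + 2 * a + b - c - d + e

recurrence-cong : ∀ {a a' b b' c c' d d' e e'} → a ≡ a' → b ≡ b' → c ≡ c' → d ≡ d' → e ≡ e' →
  recurrence a b c d e ≡ recurrence a' b' c' d' e'
recurrence-cong refl refl refl refl refl = refl

-- Each summand G(m, ρ) splits as  splitM + splitRest:  splitM is the part produced by the
-- m-recurrence of K (the summands 2 G(q) + G(q-1) moved from (m, ρ) to (m+1, ρ)), and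
-- splitRest the part produced by the ρ-recurrence of K and Pascal's rule for C(ρ+i, i)
-- (the summands -G(q) - G(q-1) moved from (m, ρ) to (m, ρ+1), plus the i - 1 terms).
splitM : ℕ → ℤ → ℕ → ℕ → ℤ
splitM i q = shiftM (λ m ρ → + 2 * G i q m ρ + G i (q - + 1) m ρ)

splitRest : ℕ → ℤ → ℕ → ℕ → ℤ
splitRest i q m       (suc ρ) = - G i q m ρ - G i (q - + 1) m ρ + Gprev i q m (suc ρ)
splitRest i q zero    zero    = G i q 0 0
splitRest i q (suc m) zero    = Gprev i q (suc m) 0

-- The ρ-recurrence part: the summand at (m, ρ+1) with the first binomial left alone.
splitRest-ρ : ∀ i q m ρ →
  + binom (m N.+ (ρ N.+ i)) (ρ N.+ i) * + binom (suc (ρ N.+ i)) i * sign (suc ρ) * kernel m (suc ρ) q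
    ≡ splitRest i q m (suc ρ)
splitRest-ρ zero q m ρ rewrite kernel-ρ-step m ρ q =
  distribute (+ binom (m N.+ (ρ N.+ 0)) (ρ N.+ 0)) (sign ρ) (kernel m ρ q) (kernel m ρ (q - + 1))
  where
  distribute : ∀ (Z S K K' : ℤ) → Z * + 1 * (- (+ 1) * S) * (K + K') ≡ - (Z * + 1 * S * K) - (Z * + 1 * S * K') + + 0
  distribute = solve-∀
splitRest-ρ (suc i) q m ρ rewrite kernel-ρ-step m ρ q | NP.+-suc ρ i =
  distribute (+ binom (m N.+ suc (ρ N.+ i)) (suc (ρ N.+ i))) (+ binom (suc (ρ N.+ i)) i) (+ binom (suc (ρ N.+ i)) (suc i))
    (sign ρ) (kernel m ρ q) (kernel m ρ (q - + 1))
  where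
  distribute : ∀ (Z A B S K K' : ℤ) →
    Z * (A + B) * (- (+ 1) * S) * (K + K') ≡ - (Z * B * S * K) - (Z * B * S * K') + Z * A * (- (+ 1) * S) * (K + K')
  distribute = solve-∀

G-split : ∀ i q m ρ → G i q m ρ ≡ splitM i q m ρ + splitRest i q m ρ
G-split i q zero zero = sym (ZP.+-identityˡ _)
G-split zero q (suc m) zero rewrite kernel-m-step m 0 q = distribute (kernel m 0 q) (kernel m 0 (q - + 1))
  where
  distribute : ∀ (K K' : ℤ) → + 1 * + 1 * + 1 * (+ 2 * K + K') ≡ (+ 2 * (+ 1 * + 1 * + 1 * K) + + 1 * + 1 * + 1 * K') + + 0
  distribute = solve-∀
G-split (suc i) q (suc m) zero rewrite kernel-m-step m 0 q | binom-diag (suc i) | binom-diag i | NP.+-suc m i =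
  distribute (+ binom (suc (m N.+ i)) i) (+ binom (suc (m N.+ i)) (suc i)) (kernel m 0 q) (kernel m 0 (q - + 1))
  where
  distribute : ∀ (A B K K' : ℤ) →
    (A + B) * + 1 * + 1 * (+ 2 * K + K') ≡ (+ 2 * (B * + 1 * + 1 * K) + B * + 1 * + 1 * K') + A * + 1 * + 1 * (+ 2 * K + K')
  distribute = solve-∀
G-split i q zero (suc ρ) =
  trans (cong (λ z → + z * + binom (suc (ρ N.+ i)) i * sign (suc ρ) * kernel 0 (suc ρ) q)
               (trans (binom-diag (suc (ρ N.+ i))) (sym (binom-diag (ρ N.+ i)))))
    (trans (splitRest-ρ i q 0 ρ) (sym (ZP.+-identityˡ _)))
G-split i q (suc m) (suc ρ) =
  begin
    G i q (suc m) (suc ρ)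
  ≡⟨ cong (λ z → (+ binom z r + + binom (m N.+ suc r) (suc r)) * Y * sign (suc ρ) * kernel (suc m) (suc ρ) q) (NP.+-suc m r) ⟩
    (A + B) * Y * sign (suc ρ) * kernel (suc m) (suc ρ) q
  ≡⟨ cong (λ z → (A + B) * Y * sign (suc ρ) * z) (kernel-m-step m (suc ρ) q) ⟩
    (A + B) * Y * sign (suc ρ) * (+ 2 * kernel m (suc ρ) q + kernel m (suc ρ) (q - + 1))
  ≡⟨ distribute A B Y (sign (suc ρ)) (kernel m (suc ρ) q) (kernel m (suc ρ) (q - + 1)) ⟩
    splitM i q (suc m) (suc ρ) + A * Y * sign (suc ρ) * (+ 2 * kernel m (suc ρ) q + kernel m (suc ρ) (q - + 1))
  ≡⟨ cong (λ z → splitM i q (suc m) (suc ρ) + A * Y * sign (suc ρ) * z) (sym (kernel-m-step m (suc ρ) q)) ⟩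
    splitM i q (suc m) (suc ρ) + A * Y * sign (suc ρ) * kernel (suc m) (suc ρ) q
  ≡⟨ cong (_+_ (splitM i q (suc m) (suc ρ))) (splitRest-ρ i q (suc m) ρ) ⟩
    splitM i q (suc m) (suc ρ) + splitRest i q (suc m) (suc ρ)
  ∎
  where
  open ≡-Reasoning
  r = ρ N.+ i
  A = + binom (suc (m N.+ r)) r
  B = + binom (m N.+ suc r) (suc r)
  Y = + binom (suc r) i
  distribute : ∀ (A B Y S K K' : ℤ) →
    (A + B) * Y * S * (+ 2 * K + K') ≡ (+ 2 * (B * Y * S * K) + B * Y * S * K') + A * Y * S * (+ 2 * K + K')
  distribute = solve-∀

-- Summing the splitting over the anti-diagonal m + 2ρ = N + 2.
F-recurrence : ∀ i N q →
  F i (suc (suc N)) q ≡ recurrence (F i (suc N) q) (F i (suc N) (q - + 1)) (F i N q) (F i N (q - + 1)) (Fprev i (suc (suc N)) q)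
F-recurrence i N q =
  begin
    antidiag (suc (suc N)) (G i q)
  ≡⟨ antidiag-cong (suc (suc N)) (G-split i q) ⟩
    antidiag (suc (suc N)) (λ m ρ → splitM i q m ρ + splitRest i q m ρ)
  ≡⟨ antidiag-+ (suc (suc N)) (splitM i q) (splitRest i q) ⟩
    antidiag (suc (suc N)) (splitM i q) + antidiag (suc (suc N)) (splitRest i q)
  ≡⟨ cong₂ _+_ sumM sumRest ⟩
    (+ 2 * F i (suc N) q + F i (suc N) (q - + 1)) + (P₀ + ((- F i N q + - F i N (q - + 1)) + P₁))
  ≡⟨ regroup (+ 2 * F i (suc N) q) (F i (suc N) (q - + 1)) (F i N q) (F i N (q - + 1)) P₀ P₁ ⟩
    recurrence (F i (suc N) q) (F i (suc N) (q - + 1)) (F i N q) (F i N (q - + 1)) (Fprev i (suc (suc N)) q)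
  ∎
  where
  open ≡-Reasoning
  P₀ = Gprev i q (suc (suc N)) 0
  P₁ = antidiag N (λ m ρ → Gprev i q m (suc ρ))
  regroup : ∀ (a b c d x y : ℤ) → (a + b) + (x + ((- c + - d) + y)) ≡ a + b - c - d + (x + y)
  regroup = solve-∀
  sumM : antidiag (suc (suc N)) (splitM i q) ≡ + 2 * F i (suc N) q + F i (suc N) (q - + 1)
  sumM = trans (antidiag-shiftM (suc N) (λ m ρ → + 2 * G i q m ρ + G i (q - + 1) m ρ))
    (trans (antidiag-+ (suc N) (λ m ρ → + 2 * G i q m ρ) (G i (q - + 1)))
      (cong (_+ F i (suc N) (q - + 1)) (antidiag-* (suc N) (+ 2) (G i q))))
  sumRest : antidiag (suc (suc N)) (splitRest i q) ≡ P₀ + ((- F i N q + - F i N (q - + 1)) + P₁)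
  sumRest = cong (_+_ P₀)
    (trans (antidiag-+ N (λ m ρ → - G i q m ρ - G i (q - + 1) m ρ) (λ m ρ → Gprev i q m (suc ρ)))
      (cong (_+ P₁)
        (trans (antidiag-+ N (λ m ρ → - G i q m ρ) (λ m ρ → - G i (q - + 1) m ρ))
          (cong₂ _+_ (antidiag-neg N (G i q)) (antidiag-neg N (G i (q - + 1)))))))

closedForm : ℕ → ℤ → ℕ → ℤ
closedForm i (+ q)    j = + binom (q N.+ i) i * + binom j (suc (q N.+ double i))
closedForm i -[1+ x ] j = + 0

closedFormN : ℕ → ℕ → ℤ → ℤ
closedFormN i N q = closedForm i q (suc (N N.+ double i))

closedFormNprev : ℕ → ℕ → ℤ → ℤ
closedFormNprev zero    N q = + 0
closedFormNprev (suc i) N q = closedFormN i N q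

double-suc : ∀ N i → N N.+ double (suc i) ≡ suc (suc (N N.+ double i))
double-suc N i = trans (NP.+-suc N (i N.+ suc i)) (cong suc (trans (cong (N N.+_) (NP.+-suc i i)) (NP.+-suc N (i N.+ i))))

-- A Pascal-rule identity in the shape of the recurrence (c = e + c' is Pascal's rule for
-- the first binomial of the closed form, u, v, w are consecutive values of the second).
recurrence-pascal : ∀ (c c' e u v w : ℤ) → c ≡ e + c' →
  c * ((u + v) + (v + w)) ≡ recurrence (c * (v + w)) (c' * (u + v)) (c * w) (c' * v) (e * u)
recurrence-pascal .(e + c') c' e u v w refl = expand e c' u v w
  where
  expand : ∀ (e c' u v w : ℤ) →
    (e + c') * ((u + v) + (v + w)) ≡ + 2 * ((e + c') * (v + w)) + c' * (u + v) - (e + c') * w - c' * v + e * u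
  expand = solve-∀

-- The closed form satisfies the recurrence of F: this is Pascal's rule applied to both
-- binomials, C(q+i, i) = C(q+i-1, i) + C(q+i-1, i-1) supplying the forcing term.
closedForm-recurrence : ∀ i N q →
  closedFormN i (suc (suc N)) q
    ≡ recurrence (closedFormN i (suc N) q) (closedFormN i (suc N) (q - + 1)) (closedFormN i N q) (closedFormN i N (q - + 1))
                 (closedFormNprev i (suc (suc N)) q)
closedForm-recurrence zero    N -[1+ x ] = refl
closedForm-recurrence (suc i) N -[1+ x ] = refl
closedForm-recurrence zero    N (+ zero) = pascal (+ binom (N N.+ double 0) 1)
  where
  pascal : ∀ (b : ℤ) → + 1 * (+ 1 + (+ 1 + (+ 1 + b))) ≡ + 2 * (+ 1 * (+ 1 + (+ 1 + b))) + + 0 - + 1 * (+ 1 + b) - + 0 + + 0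
  pascal = solve-∀
closedForm-recurrence (suc i) N (+ zero)
  rewrite binom-diag i | binom-above i (suc i) NP.≤-refl | double-suc N i | NP.+-suc i i =
  pascal (+ binom (suc (suc (suc (N N.+ double i)))) (suc (double i)))
         (+ binom (suc (suc (suc (N N.+ double i)))) (suc (suc (double i))))
         (+ binom (suc (suc (suc (N N.+ double i)))) (suc (suc (suc (double i)))))
  where
  pascal : ∀ (u v w : ℤ) → + 1 * ((u + v) + (v + w)) ≡ + 2 * (+ 1 * (v + w)) + + 0 - + 1 * w - + 0 + + 1 * u
  pascal = solve-∀
closedForm-recurrence zero    N (+ suc q) =
  recurrence-pascal (+ 1) (+ 1) (+ 0) (+ binom (suc (N N.+ 0)) (q N.+ 0)) (+ binom (suc (N N.+ 0)) (suc (q N.+ 0)))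
         (+ binom (suc (N N.+ 0)) (suc (suc (q N.+ 0)))) refl
closedForm-recurrence (suc i) N (+ suc q) rewrite double-suc N i | double-suc q i | NP.+-suc q i =
  recurrence-pascal (+ binom (suc (suc (q N.+ i))) (suc i)) (+ binom (suc (q N.+ i)) (suc i)) (+ binom (suc (q N.+ i)) i) _ _ _ refl

F≡closedForm-0 : ∀ i q → + binom i i * + binom i i * + 1 * δ q ≡ closedFormN i 0 q
F≡closedForm-0 i (+ zero) rewrite binom-diag i | binom-diag (suc (double i)) = refl
F≡closedForm-0 i (+ suc q)
  rewrite binom-diag i | binom-above (suc (double i)) (suc (suc q N.+ double i)) (s≤s (s≤s (NP.m≤n+m (double i) q))) =
  sym (ZP.*-zeroʳ (+ binom (suc q N.+ i) i))
F≡closedForm-0 i -[1+ x ] = ZP.*-zeroʳ (+ binom i i * + binom i i * + 1)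

F≡closedForm-1 : ∀ i q → + binom (suc i) i * + binom i i * + 1 * (+ 2 * δ q + δ (q - + 1)) ≡ closedFormN i 1 q
F≡closedForm-1 i (+ zero) rewrite binom-diag i | binom-subdiag i | binom-subdiag (suc (double i)) = compute (+ i)
  where
  compute : ∀ (I : ℤ) → (+ 1 + I) * + 1 * + 1 * (+ 2 * + 1 + + 0) ≡ + 1 * (+ 2 + (I + I))
  compute = solve-∀
F≡closedForm-1 i (+ suc zero) rewrite binom-diag i | binom-subdiag i | binom-diag (suc (suc (double i))) = compute (+ i)
  where
  compute : ∀ (I : ℤ) → (+ 1 + I) * + 1 * + 1 * (+ 2 * + 0 + + 1) ≡ (+ 1 + I) * + 1
  compute = solve-∀
F≡closedForm-1 i (+ suc (suc q))
  rewrite binom-diag i | binom-subdiag i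
        | binom-above (suc (suc (double i))) (suc (suc (suc q N.+ double i))) (s≤s (s≤s (s≤s (NP.m≤n+m (double i) q)))) =
  compute (+ i) (+ binom (suc (suc q N.+ i)) i)
  where
  compute : ∀ (I C : ℤ) → (+ 1 + I) * + 1 * + 1 * (+ 2 * + 0 + + 0) ≡ C * + 0
  compute = solve-∀
F≡closedForm-1 i -[1+ x ] = ZP.*-zeroʳ (+ binom (suc i) i * + binom i i * + 1)

F≡closedForm : ∀ i N q → F i N q ≡ closedFormN i N q
Fprev≡closedFormNprev : ∀ i N q → Fprev i N q ≡ closedFormNprev i N q

F≡closedForm i zero q = trans (cong (λ z → + binom i i * + binom i i * + 1 * z) (kernel-base q)) (F≡closedForm-0 i q)
F≡closedForm i (suc zero) q =
  trans (cong (λ z → + binom (suc i) i * + binom i i * + 1 * z)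
              (trans (kernel-m-step 0 0 q) (cong₂ (λ a b → + 2 * a + b) (kernel-base q) (kernel-base (q - + 1)))))
    (F≡closedForm-1 i q)
F≡closedForm i (suc (suc N)) q =
  trans (F-recurrence i N q)
    (trans (recurrence-cong (F≡closedForm i (suc N) q) (F≡closedForm i (suc N) (q - + 1))
                            (F≡closedForm i N q) (F≡closedForm i N (q - + 1)) (Fprev≡closedFormNprev i (suc (suc N)) q))
      (sym (closedForm-recurrence i N q)))

Fprev≡closedFormNprev zero    N q = antidiag-zero N
Fprev≡closedFormNprev (suc i) N q = F≡closedForm i N q

-- The shift  q = (n - t) - (2i + 1)  that turns the k-sum into a value of the kernel.
shift : ℕ → ℕ → ℕ → ℤ
shift n t i = + (n ∸ t) - + suc (double i)

shift-nonneg : ∀ s c → c ≤ s → + s - + c ≡ + (s ∸ c)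
shift-nonneg s c c≤s = trans (ZP.m-n≡m⊖n s c) (ZP.⊖-≥ c≤s)

shift-neg : ∀ s c → s ≤ c → + s - + suc c ≡ -[1+ (c ∸ s) ]
shift-neg s c s≤c =
  trans (ZP.m-n≡m⊖n s (suc c)) (trans (ZP.⊖-< (s≤s s≤c)) (cong (λ z → - (+ z)) (NP.+-∸-assoc 1 s≤c)))

outerFactor : ℕ → ℕ → ℕ → ℤ
outerFactor n t j = + (n C j) * sign (t N.+ j N.+ n)

summand : (n t i j r X A k : ℕ) → ℤ
summand n t i j r X A k =
  + (n C j) * + (A C r) * + (X C k) * + (r C i) * binomℤ (r ∸ i) (+ j - + k - + r + + i - + n + + t)
    * (- (+ 1)) ^ (r N.+ t N.+ j N.+ n N.+ i) * (+ 2) ^ k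

kSum : ℕ → ℕ → ℕ → ℕ → ℕ → ℤ
kSum n t i j r = sumRange 0 (j ∸ 1 ∸ 2 N.* r) (summand n t i j r (j ∸ 1 ∸ 2 N.* r) (j ∸ 1 ∸ r))

rSum : ℕ → ℕ → ℕ → ℕ → ℤ
rSum n t i j = sumRange i ((j ∸ 1) / 2) (kSum n t i j)

kSum-general : ∀ n t i m ρ X A → t ≤ n → X ≡ m → A ≡ m N.+ (ρ N.+ i) →
  let J = suc (m N.+ 2 N.* ρ N.+ double i) in
  sumRange 0 X (summand n t i J (i N.+ ρ) X A) ≡ outerFactor n t J * G i (shift n t i) m ρ
kSum-general n t i m ρ .m .(m N.+ (ρ N.+ i)) t≤n refl refl =
  begin
    sumFrom 0 (suc m) (summand n t i J (i N.+ ρ) m (m N.+ (ρ N.+ i)))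
  ≡⟨ sumFrom-cong 0 (suc m) term ⟩
    sumFrom 0 (suc m) (λ k → c * (+ binom m k * ((+ 2) ^ k * binomZ ρ (bottom k))))
  ≡⟨ sumFrom-* 0 (suc m) c (λ k → + binom m k * ((+ 2) ^ k * binomZ ρ (bottom k))) ⟩
    c * sumFrom 0 (suc m) (λ k → + binom m k * ((+ 2) ^ k * binomZ ρ (bottom k)))
  ≡⟨ cong (c *_) (sym (kernel-unfold m ρ q)) ⟩
    c * kernel m ρ q
  ≡⟨ ZP.*-assoc (outerFactor n t J) (B₁ * B₂ * sign ρ) (kernel m ρ q) ⟩
    outerFactor n t J * G i q m ρ
  ∎
  where
  open ≡-Reasoning
  J = suc (m N.+ 2 N.* ρ N.+ double i)
  q = shift n t i
  bottom : ℕ → ℤ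
  bottom k = + m + + ρ - q - + k
  B₁ = + binom (m N.+ (ρ N.+ i)) (ρ N.+ i)
  B₂ = + binom (ρ N.+ i) i
  c = outerFactor n t J * (B₁ * B₂ * sign ρ)

  bottom-eq : ∀ k → + J - + k - + (i N.+ ρ) + + i - + n + + t ≡ bottom k
  bottom-eq k = reorder (+ m) (+ ρ) (+ i) (+ k) (+ (n ∸ t)) (+ t) (+ n) (cong +_ (sym (NP.m∸n+n≡m t≤n)))
    where
    reorder : ∀ (M R I K S T Nn : ℤ) → Nn ≡ S + T →
      (+ 1 + (M + (R + (R + + 0)) + (I + I))) - K - (I + R) + I - Nn + T ≡ M + R - (S - (+ 1 + (I + I))) - K
    reorder M R I K S T .(S + T) refl = expand M R I K S T
      where
      expand : ∀ (M R I K S T : ℤ) → (+ 1 + (M + (R + (R + + 0)) + (I + I))) - K - (I + R) + I - (S + T) + T ≡ M + R - (S - (+ 1 + (I + I))) - K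
      expand = solve-∀

  -- (-1)^(r+t+j+n+i) = (-1)^(t+j+n) (-1)^ρ, since r + i = ρ + 2i
  sign-eq : sign (i N.+ ρ N.+ t N.+ J N.+ n N.+ i) ≡ sign (t N.+ J N.+ n) * sign ρ
  sign-eq =
    begin
      sign (i N.+ ρ N.+ t N.+ J N.+ n N.+ i)
    ≡⟨ cong sign (exponent i ρ t J n) ⟩
      sign ((t N.+ J N.+ n) N.+ (ρ N.+ double i))
    ≡⟨ sign-+ (t N.+ J N.+ n) (ρ N.+ double i) ⟩
      sign (t N.+ J N.+ n) * sign (ρ N.+ double i)
    ≡⟨ cong (sign (t N.+ J N.+ n) *_) (trans (sign-+ ρ (double i)) (cong (sign ρ *_) (trans (sign-+ i i) (sign-square i)))) ⟩
      sign (t N.+ J N.+ n) * (sign ρ * + 1)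
    ≡⟨ cong (sign (t N.+ J N.+ n) *_) (ZP.*-identityʳ (sign ρ)) ⟩
      sign (t N.+ J N.+ n) * sign ρ
    ∎
    where
    exponent : ∀ i ρ t J n → i N.+ ρ N.+ t N.+ J N.+ n N.+ i ≡ (t N.+ J N.+ n) N.+ (ρ N.+ (i N.+ i))
    exponent = NS.solve-∀

  factors : ∀ {c₁ a a' b b' e e' f f' s s' p : ℤ} → a ≡ a' → b ≡ b' → e ≡ e' → f ≡ f' → s ≡ s' →
    c₁ * a * b * e * f * s * p ≡ c₁ * a' * b' * e' * f' * s' * p
  factors refl refl refl refl refl = refl

  regroup : ∀ (c₁ B₁ Bk B₂ Z S₁ Sρ P : ℤ) →
    c₁ * B₁ * Bk * B₂ * Z * (S₁ * Sρ) * P ≡ ((c₁ * S₁) * ((B₁ * B₂) * Sρ)) * (Bk * (P * Z))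
  regroup = solve-∀

  term : ∀ k → summand n t i J (i N.+ ρ) m (m N.+ (ρ N.+ i)) k ≡ c * (+ binom m k * ((+ 2) ^ k * binomZ ρ (bottom k)))
  term k =
    trans (factors {c₁ = + (n C J)} {p = (+ 2) ^ k}
            (cong +_ (trans (binom≡C (m N.+ (ρ N.+ i)) (i N.+ ρ)) (cong (binom (m N.+ (ρ N.+ i))) (NP.+-comm i ρ))))
            (cong +_ (binom≡C m k))
            (cong +_ (trans (binom≡C (i N.+ ρ) i) (cong (λ z → binom z i) (NP.+-comm i ρ))))
            (trans (binomℤ≡binomZ _ _) (cong₂ binomZ (NP.m+n∸m≡n i ρ) (bottom-eq k)))
            sign-eq)
      (regroup (+ (n C J)) B₁ (+ binom m k) B₂ (binomZ ρ (bottom k)) (sign (t N.+ J N.+ n)) (sign ρ) ((+ 2) ^ k))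

kSum-kernel : ∀ n t i m ρ → t ≤ n →
  kSum n t i (suc (m N.+ 2 N.* ρ N.+ double i)) (i N.+ ρ) ≡ outerFactor n t (suc (m N.+ 2 N.* ρ N.+ double i)) * G i (shift n t i) m ρ
kSum-kernel n t i m ρ t≤n = kSum-general n t i m ρ _ _ t≤n X-eq A-eq
  where
  X-eq : m N.+ 2 N.* ρ N.+ double i ∸ 2 N.* (i N.+ ρ) ≡ m
  X-eq = trans (cong (_∸ 2 N.* (i N.+ ρ)) (expand m ρ i)) (NP.m+n∸n≡m m (2 N.* (i N.+ ρ)))
    where
    expand : ∀ m ρ i → m N.+ 2 N.* ρ N.+ (i N.+ i) ≡ m N.+ 2 N.* (i N.+ ρ)
    expand = NS.solve-∀
  A-eq : m N.+ 2 N.* ρ N.+ double i ∸ (i N.+ ρ) ≡ m N.+ (ρ N.+ i)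
  A-eq = trans (cong (_∸ (i N.+ ρ)) (expand m ρ i)) (NP.m+n∸n≡m (m N.+ (ρ N.+ i)) (i N.+ ρ))
    where
    expand : ∀ m ρ i → m N.+ 2 N.* ρ N.+ (i N.+ i) ≡ m N.+ (ρ N.+ i) N.+ (i N.+ ρ)
    expand = NS.solve-∀

-- ⌊(N + 2i)/2⌋ = i + ⌊N/2⌋: the r-range for j = 1 + N + 2i is r = i + ρ with ρ ≤ ⌊N/2⌋.
half-double : ∀ N i → (N N.+ double i) / 2 ≡ i N.+ N / 2
half-double N zero    = cong (_/ 2) (NP.+-identityʳ N)
half-double N (suc i) =
  trans (cong (_/ 2) (double-suc N i))
    (trans (DM.m/n≡1+[m∸n]/n {suc (suc (N N.+ double i))} {2} (s≤s (s≤s z≤n))) (cong suc (half-double N i)))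

rSum-antidiag : ∀ n t i N → t ≤ n →
  rSum n t i (suc (N N.+ double i)) ≡ outerFactor n t (suc (N N.+ double i)) * F i N (shift n t i)
rSum-antidiag n t i N t≤n =
  begin
    sumRange i ((N N.+ double i) / 2) (kSum n t i J)
  ≡⟨ cong (λ h → sumRange i h (kSum n t i J)) (half-double N i) ⟩
    sumRange i (i N.+ N / 2) (kSum n t i J)
  ≡⟨ sumRange-nonempty i (N / 2) (kSum n t i J) ⟩
    sumFrom 0 (suc (N / 2)) (λ ρ → kSum n t i J (i N.+ ρ))
  ≡⟨ sumFrom-cong< (suc (N / 2)) term ⟩
    sumFrom 0 (suc (N / 2)) (λ ρ → c * G i q (N ∸ 2 N.* ρ) ρ)
  ≡⟨ sumFrom-* 0 (suc (N / 2)) c (λ ρ → G i q (N ∸ 2 N.* ρ) ρ) ⟩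
    c * sumFrom 0 (suc (N / 2)) (λ ρ → G i q (N ∸ 2 N.* ρ) ρ)
  ≡⟨ cong (c *_) (antidiag-as-sum N (G i q)) ⟩
    c * F i N q
  ∎
  where
  open ≡-Reasoning
  J = suc (N N.+ double i)
  q = shift n t i
  c = outerFactor n t J
  term : ∀ ρ → ρ < suc (N / 2) → kSum n t i J (i N.+ ρ) ≡ c * G i q (N ∸ 2 N.* ρ) ρ
  term ρ (s≤s ρ≤N/2) =
    subst (λ M → kSum n t i (suc (M N.+ double i)) (i N.+ ρ) ≡ outerFactor n t (suc (M N.+ double i)) * G i q m ρ)
          (NP.m∸n+n≡m (half-bound N ρ ρ≤N/2))
          (kSum-kernel n t i m ρ t≤n)
    where
    m = N ∸ 2 N.* ρ

-- The closed form vanishes for j ≤ 2i, where the r-range is empty.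
closedForm-below : ∀ i q j → j < double i → closedForm i q (suc j) ≡ + 0
closedForm-below i (+ q) j j<2i
  rewrite binom-above (suc j) (suc (q N.+ double i)) (s≤s (NP.≤-trans j<2i (NP.m≤n+m (double i) q))) =
  ZP.*-zeroʳ (+ binom (q N.+ i) i)
closedForm-below i -[1+ x ] j j<2i = refl

rSum-closed : ∀ n t i j → t ≤ n → rSum n t i (suc j) ≡ outerFactor n t (suc j) * closedForm i (shift n t i) (suc j)
rSum-closed n t i j t≤n with double i NP.≤? j
... | yes 2i≤j =
  subst (λ J → rSum n t i (suc J) ≡ outerFactor n t (suc J) * closedForm i (shift n t i) (suc J))
        (NP.m∸n+n≡m 2i≤j)
        (trans (rSum-antidiag n t i (j ∸ double i) t≤n)
               (cong (outerFactor n t (suc (j ∸ double i N.+ double i)) *_) (F≡closedForm i (j ∸ double i) (shift n t i))))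
... | no 2i≰j =
  trans (sumRange-empty i (j / 2) (kSum n t i (suc j)) (NP.≰⇒> (λ i≤j/2 → 2i≰j (double-bound j i i≤j/2))))
    (sym (trans (cong (outerFactor n t (suc j) *_) (closedForm-below i (shift n t i) j (NP.≰⇒> 2i≰j)))
                (ZP.*-zeroʳ (outerFactor n t (suc j)))))

jSum : ℕ → ℕ → ℕ → ℤ → ℤ
jSum n t i q = sumFrom 0 n (λ j → outerFactor n t (suc j) * closedForm i q (suc j))

-- For q ≥ 0 the j-sum is an alternating binomial sum; the term j = 0 is zero.
jSum-nonneg : ∀ n t i q → jSum n t i (+ q) ≡ (+ binom (q N.+ i) i * sign t) * alternating n (suc (q N.+ double i))
jSum-nonneg n t i q =
  begin
    jSum n t i (+ q)
  ≡⟨ sym (ZP.+-identityˡ _) ⟩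
    + 0 + sumFrom 0 n (λ j → h (suc j))
  ≡⟨ cong₂ _+_ (sym h₀) (sym (sumFrom-shift 0 n h)) ⟩
    sumFrom 0 (suc n) h
  ≡⟨ sumFrom-cong 0 (suc n) term ⟩
    sumFrom 0 (suc n) (λ j → c * (+ binom n j * (+ binom j s * sign (j N.+ n))))
  ≡⟨ sumFrom-* 0 (suc n) c (λ j → + binom n j * (+ binom j s * sign (j N.+ n))) ⟩
    c * alternating n s
  ∎
  where
  open ≡-Reasoning
  s = suc (q N.+ double i)
  B = + binom (q N.+ i) i
  c = B * sign t
  h : ℕ → ℤ
  h j = outerFactor n t j * closedForm i (+ q) j
  h₀ : h 0 ≡ + 0
  h₀ = trans (cong (outerFactor n t 0 *_) (ZP.*-zeroʳ B)) (ZP.*-zeroʳ (outerFactor n t 0))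
  regroup : ∀ (Bn St Sjn B Bj : ℤ) → (Bn * (St * Sjn)) * (B * Bj) ≡ (B * St) * (Bn * (Bj * Sjn))
  regroup = solve-∀
  term : ∀ j → h j ≡ c * (+ binom n j * (+ binom j s * sign (j N.+ n)))
  term j =
    trans (cong₂ (λ a b → (+ a * b) * closedForm i (+ q) j) (binom≡C n j) (trans (cong sign (NP.+-assoc t j n)) (sign-+ t (j N.+ n))))
      (regroup (+ binom n j) (sign t) (sign (j N.+ n)) B (+ binom j s))

jSum-neg : ∀ n t i x → jSum n t i -[1+ x ] ≡ + 0
jSum-neg n t i x = sumFrom-zero 0 n _ (λ j → ZP.*-zeroʳ (outerFactor n t (suc j)))

-- t = 0: then q = n - 1 - 2i ≥ 0 and only the term j = n survives.
jSum-t≡0 : ∀ n' i → double i ≤ n' → jSum (suc n') 0 i (shift (suc n') 0 i) ≡ + ((n' ∸ i) C i)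
jSum-t≡0 n' i 2i≤n' =
  begin
    jSum n 0 i (shift n 0 i)
  ≡⟨ cong (jSum n 0 i) (shift-nonneg n (suc (double i)) (s≤s 2i≤n')) ⟩
    jSum n 0 i (+ q)
  ≡⟨ jSum-nonneg n 0 i q ⟩
    (B * + 1) * alternating n s
  ≡⟨ cong ((B * + 1) *_) (alternating-sum n s) ⟩
    (B * + 1) * (if n ≡ᵇ s then + 1 else + 0)
  ≡⟨ cong (λ b → (B * + 1) * (if b then + 1 else + 0)) (T⇒≡true (NP.≡⇒≡ᵇ n s n≡s)) ⟩
    (B * + 1) * + 1
  ≡⟨ trans (ZP.*-identityʳ (B * + 1)) (ZP.*-identityʳ B) ⟩
    B
  ≡⟨ cong +_ (trans (cong (λ z → binom z i) (sym n'-i≡q+i)) (sym (binom≡C (n' ∸ i) i))) ⟩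
    + ((n' ∸ i) C i)
  ∎
  where
  open ≡-Reasoning
  n = suc n'
  q = n' ∸ double i
  s = suc (q N.+ double i)
  B = + binom (q N.+ i) i
  n≡s : n ≡ s
  n≡s = cong suc (sym (NP.m∸n+n≡m 2i≤n'))
  n'-i≡q+i : n' ∸ i ≡ q N.+ i
  n'-i≡q+i = trans (cong (_∸ i) (trans (sym (NP.m∸n+n≡m 2i≤n')) (sym (NP.+-assoc q i i)))) (NP.m+n∸n≡m (q N.+ i) i)

-- t > 0: either q < 0, or q ≥ 0 and n ≠ q + 2i + 1 = n - t; in both cases the j-sum vanishes.
jSum-t>0 : ∀ n' t' i → jSum (suc n') (suc t') i (shift (suc n') (suc t') i) ≡ + 0
jSum-t>0 n' t' i with suc (double i) NP.≤? n' ∸ t'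
... | yes 2i<s =
  begin
    jSum n t i (shift n t i)
  ≡⟨ cong (jSum n t i) (shift-nonneg (n' ∸ t') (suc (double i)) 2i<s) ⟩
    jSum n t i (+ q)
  ≡⟨ jSum-nonneg n t i q ⟩
    c * alternating n s
  ≡⟨ cong (c *_) (alternating-sum n s) ⟩
    c * (if n ≡ᵇ s then + 1 else + 0)
  ≡⟨ cong (λ b → c * (if b then + 1 else + 0)) (¬T⇒≡false (λ n≡ᵇs → n≢s (NP.≡ᵇ⇒≡ n s n≡ᵇs))) ⟩
    c * + 0
  ≡⟨ ZP.*-zeroʳ c ⟩
    + 0
  ∎
  where
  open ≡-Reasoning
  n = suc n'
  t = suc t'
  q = n' ∸ t' ∸ suc (double i)
  s = suc (q N.+ double i)
  c = + binom (q N.+ i) i * sign t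
  -- s = n - t ≤ n - 1
  n≢s : n ≢ s
  n≢s n≡s = NP.1+n≰n (NP.≤-trans (NP.≤-reflexive (trans n≡s s≡n-t)) (NP.m∸n≤m n' t'))
    where
    s≡n-t : s ≡ n' ∸ t'
    s≡n-t = trans (sym (NP.+-suc q (double i))) (NP.m∸n+n≡m 2i<s)
... | no 2i≮s =
  trans (cong (jSum (suc n') (suc t') i) (shift-neg (n' ∸ t') (double i) (NP.≤-pred (NP.≰⇒> 2i≮s))))
    (jSum-neg (suc n') (suc t') i (double i ∸ (n' ∸ t')))

proposition3 : (n t i : ℕ) → 1 ≤ n → t ≤ n → i ≤ (n ∸ 1) / 2 →
    sumRange 1 n (λ j →
      sumRange i ((j ∸ 1) / 2) (λ r →
        sumRange 0 (j ∸ 1 ∸ 2 Data.Nat.* r) (λ k →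
          + (n C j) * + ((j ∸ 1 ∸ r) C r) * + ((j ∸ 1 ∸ 2 Data.Nat.* r) C k)
            * + (r C i)
            * binomℤ (r ∸ i) (+ j - + k - + r + + i - + n + + t)
            * (- (+ 1)) ^ (r Data.Nat.+ t Data.Nat.+ j Data.Nat.+ n Data.Nat.+ i)
            * (+ 2) ^ k)))
    ≡ (if t ≡ᵇ 0 then + ((n ∸ 1 ∸ i) C i) else + 0)
proposition3 (suc n') t i (s≤s z≤n) t≤n i≤n'/2 =
  begin
    sumFrom 1 n (rSum n t i)
  ≡⟨ sumFrom-shift 0 n (rSum n t i) ⟩
    sumFrom 0 n (λ j → rSum n t i (suc j))
  ≡⟨ sumFrom-cong 0 n (λ j → rSum-closed n t i j t≤n) ⟩
    jSum n t i (shift n t i)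
  ≡⟨ evaluate t ⟩
    (if t ≡ᵇ 0 then + ((n' ∸ i) C i) else + 0)
  ∎
  where
  open ≡-Reasoning
  n = suc n'
  evaluate : ∀ t → jSum n t i (shift n t i) ≡ (if t ≡ᵇ 0 then + ((n' ∸ i) C i) else + 0)
  evaluate zero     = jSum-t≡0 n' i (double-bound n' i i≤n'/2)
  evaluate (suc t') = jSum-t>0 n' t' i
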